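{- $\textsc{Empty-Child}$ reduces (by a black-box $\le_{dt}$ reduction) to $\textsc{Nephew-w-Inverse}$.
   Context: Query model with $\le_{dt}$ reductions (decision-tree reductions with log target-input-length plus depth $\mathrm{polylog}$ in the source size). $\textsc{Empty-Child}$: given $V=[N]$ and $F,L,R:V\to V$, a solution is (s1) $u$ with $F(L(u))\ne u$ or $F(R(u))\ne u$ or $L(u)=R(u)\ne u$, or (s2) $1$ if $L(1)=1$ or $R(1)=1$ or $F(1)\ne1$. $\textsc{Nephew-w-Inverse}$: given a finite set $V$, functions $f,g:V\to V$ and $f^{ -1}:V\to V\cup\{\bot\}$, a solution is $u\in V$ with $f(f(g(u)))\ne f(u)$; or $u$ with $f(g(u))=u$; or $v$ with $f^{ -1}(v)\ne\bot$ and $f(f^{ -1}(v))\ne v$; or $v$ with $f^{ -1}(v)=\bot$ and $f(f(v))\ne f(v)$. -}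

module Defs where

open import Data.Nat using (ℕ; zero; suc; _+_; _^_; _≤_)
open import Data.Nat.Logarithm using (⌈log₂_⌉)
open import Data.Fin using (Fin; zero; suc)
open import Data.Maybe using (Maybe; just; nothing)
open import Data.Product using (Σ; _×_; _,_)
open import Data.Sum using (_⊎_)
open import Relation.Binary.PropositionalEquality using (_≡_; _≢_)

data DT (Q : Set) (A : Q → Set) (R : Set) : Set where
  leaf  : R → DT Q A R
  query : (q : Q) → (A q → DT Q A R) → DT Q A R

eval : ∀ {Q A R} → DT Q A R → ((q : Q) → A q) → R
eval (leaf r)    x = r
eval (query q k) x = eval (k (x q)) x

data DepthLe {Q : Set} {A : Q → Set} {R : Set} : DT Q A R → ℕ → Set where
  leaf≤  : ∀ {r d} → DepthLe (leaf r) d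
  query≤ : ∀ {q k d} → (∀ a → DepthLe (k a) d) → DepthLe (query q k) (suc d)

-- Instances of size n are oracles (q : Query n) → Answer n q,
-- outputs (candidate solutions) range over Out n, and Sol says
-- which outputs are solutions. `size n` is the number of vertices.

record QueryProblem : Set₁ where
  field
    Query  : ℕ → Set
    Answer : (n : ℕ) → Query n → Set
    Out    : ℕ → Set
    Sol    : (n : ℕ) → ((q : Query n) → Answer n q) → Out n → Set
    size   : ℕ → ℕ

open QueryProblem public

polylog : ℕ → ℕ → ℕ
polylog c N = (2 + ⌈log₂ N ⌉) ^ c

record DtRedAt (P P' : QueryProblem) (c n : ℕ) : Set where
  field
    m       : ℕ
    instT   : (q' : Query P' m) → DT (Query P n) (Answer P n) (Answer P' m q')
    outT    : (o' : Out P' m) → DT (Query P n) (Answer P n) (Out P n)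
    correct : (x : (q : Query P n) → Answer P n q) (o' : Out P' m) →
              Sol P' m (λ q' → eval (instT q') x) o' →
              Sol P n x (eval (outT o') x)
    logSize : ⌈log₂ (size P' m) ⌉ ≤ polylog c (size P n)
    instDepth : ∀ q' → DepthLe (instT q') (polylog c (size P n))
    outDepth  : ∀ o' → DepthLe (outT o') (polylog c (size P n))

_≤dt_ : QueryProblem → QueryProblem → Set
P ≤dt P' = Σ ℕ λ c → (n : ℕ) → DtRedAt P P' c n

-- EMPTY-CHILD with V = [N], N = suc n; vertex 1 is `zero`.

data ECQuery (N : ℕ) : Set where
  qF qL qR : Fin N → ECQuery N

module _ {N : ℕ} (F L R : Fin N → Fin N) where
  EC-S1 : Fin N → Set
  EC-S1 u = (F (L u) ≢ u) ⊎ (F (R u) ≢ u) ⊎ (L u ≡ R u × R u ≢ u)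

EmptyChild : QueryProblem
EmptyChild = record
  { Query  = λ n → ECQuery (suc n)
  ; Answer = λ n _ → Fin (suc n)
  ; Out    = λ n → Fin (suc n)
  ; Sol    = λ n x u →
      let F = λ i → x (qF i) ; L = λ i → x (qL i) ; R = λ i → x (qR i) in
      EC-S1 F L R u
      ⊎ (u ≡ zero × ((L zero ≡ zero) ⊎ (R zero ≡ zero) ⊎ (F zero ≢ zero)))
  ; size   = suc
  }

-- NEPHEW-W-INVERSE with V = Fin M, M = suc m; ⊥ is `nothing`.

data NWQuery (M : ℕ) : Set where
  qf qg qfinv : Fin M → NWQuery M

NWAnswer : (M : ℕ) → NWQuery M → Set
NWAnswer M (qf _)    = Fin M
NWAnswer M (qg _)    = Fin M
NWAnswer M (qfinv _) = Maybe (Fin M)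

module _ {M : ℕ} (f g : Fin M → Fin M) (finv : Fin M → Maybe (Fin M)) where
  NW-Sol : Fin M → Set
  NW-Sol u = (f (f (g u)) ≢ f u)
           ⊎ (f (g u) ≡ u)
           ⊎ (Σ (Fin M) λ w → finv u ≡ just w × f w ≢ u)
           ⊎ (finv u ≡ nothing × f (f u) ≢ f u)

NephewWInverse : QueryProblem
NephewWInverse = record
  { Query  = λ m → NWQuery (suc m)
  ; Answer = λ m → NWAnswer (suc m)
  ; Out    = λ m → Fin (suc m)
  ; Sol    = λ m x u → NW-Sol (λ i → x (qf i)) (λ i → x (qg i)) (λ i → x (qfinv i)) u
  ; size   = suc
  }

-- Read (F, L, R) as a binary tree rooted at 1 with parent map F, in which
-- L u = u or R u = u marks a missing child.  The Nephew instance keeps the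
-- parent link u ↦ F u only when u ≠ 1 and F u has two children, sending every
-- other vertex to the root; g u is a child of the sibling of u, or L (L 1)
-- when u has no such parent; f⁻¹ v is L v when v has two children.  If the
-- root, its left child, v, the parent of v and that parent's two children are
-- all locally consistent, then f (f (g v)) = f v, f (g v) ≠ v and f⁻¹ is a
-- correct partial inverse at v.  So a Nephew solution v yields an Empty-Child
-- solution among these six vertices, each checked with O(1) queries.
module Submission where

open import Defs
open import Data.Nat using (ℕ; suc; _+_; _*_; _^_; _≤_; s≤s)
open import Data.Nat.Properties
  using (≤-trans; +-identityʳ; ^-monoˡ-≤; m≤m+n; m≤n+m; m≤m*n; m^n≢0)
open import Data.Nat.Logarithm using (⌈log₂_⌉)
open import Data.Fin using (Fin; zero)
open import Data.Fin.Properties using (_≟_)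
open import Data.Bool using (true; false; if_then_else_)
open import Data.Maybe using (Maybe; just; nothing)
open import Data.Product using (Σ; _×_; _,_; proj₁; proj₂)
open import Data.Sum using (_⊎_; inj₁; inj₂)
import Data.Sum as Sum
open import Data.List using (List; []; _∷_; length; map)
open import Data.List.Relation.Unary.All using (All; []; _∷_)
open import Relation.Nullary using (¬_; Dec; yes; no; does; contradiction)
open import Relation.Nullary.Decidable
  using (¬?; _×-dec_; _⊎-dec_; dec-true; dec-false; decidable-stable)
open import Relation.Binary.PropositionalEquality
  using (_≡_; _≢_; refl; sym; trans; cong; subst; module ≡-Reasoning)

module BoundedDT {Q : Set} {A : Q → Set} where

  DT≤ : Set → ℕ → Set
  DT≤ R d = Σ (DT Q A R) λ t → DepthLe t d

  DepthLe-mono : ∀ {R} {t : DT Q A R} {d e} → DepthLe t d → d ≤ e → DepthLe t e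
  DepthLe-mono leaf≤      _         = leaf≤
  DepthLe-mono (query≤ h) (s≤s d≤e) = query≤ λ a → DepthLe-mono (h a) d≤e

  bind : ∀ {R S} → DT Q A R → (R → DT Q A S) → DT Q A S
  bind (leaf r)    k = k r
  bind (query q c) k = query q λ a → bind (c a) k

  DepthLe-bind : ∀ {R S} {t : DT Q A R} {k : R → DT Q A S} {d e} →
                 DepthLe t d → (∀ r → DepthLe (k r) e) → DepthLe (bind t k) (d + e)
  DepthLe-bind {d = d} {e} (leaf≤ {r = r}) hk = DepthLe-mono (hk r) (m≤n+m e d)
  DepthLe-bind (query≤ h) hk = query≤ λ a → DepthLe-bind (h a) hk

  weaken : ∀ {R d e} → d ≤ e → DT≤ R d → DT≤ R e
  weaken d≤e (t , t≤d) = t , DepthLe-mono t≤d d≤e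

  return : ∀ {R} → R → DT≤ R 0
  return r = leaf r , leaf≤

  _>>=_ : ∀ {R S d e} → DT≤ R d → (R → DT≤ S e) → DT≤ S (d + e)
  (t , t≤d) >>= k = bind t (λ r → proj₁ (k r)) , DepthLe-bind t≤d (λ r → proj₂ (k r))

  _<$>_ : ∀ {R S d} → (R → S) → DT≤ R d → DT≤ S d
  h <$> (t , t≤d) =
    bind t (λ r → leaf (h r)) ,
    subst (DepthLe _) (+-identityʳ _) (DepthLe-bind t≤d λ _ → leaf≤ {d = 0})

  ask : (q : Q) → DT≤ (A q) 1
  ask q = query q leaf , query≤ λ _ → leaf≤

2^c≤polylog : ∀ c N → 2 ^ c ≤ polylog c N
2^c≤polylog c N = ^-monoˡ-≤ c (m≤m+n 2 ⌈log₂ N ⌉)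

log₂≤polylog : ∀ c N → ⌈log₂ N ⌉ ≤ polylog (suc c) N
log₂≤polylog c N = ≤-trans (m≤n+m ⌈log₂ N ⌉ 2) (m≤m*n k (k ^ c) {{m^n≢0 k c}})
  where
  k : ℕ
  k = 2 + ⌈log₂ N ⌉

module _ {A B : Set} {P : A → B → Set} (P? : ∀ a b → Dec (P a b)) where

  firstWitness : A → List (A × B) → A
  firstWitness d []              = d
  firstWitness d ((a , b) ∷ abs) = if does (P? a b) then a else firstWitness d abs

  firstWitness-sound : (h : A → B) (d : A) (as : List A) →
                       let r = firstWitness d (map (λ a → a , h a) as) in
                       P r (h r) ⊎ All (λ a → ¬ P a (h a)) as
  firstWitness-sound h d []       = inj₂ []
  firstWitness-sound h d (a ∷ as) with P? a (h a)
  ... | yes pa  = inj₁ pa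
  ... | no  ¬pa = Sum.map₂ (¬pa ∷_) (firstWitness-sound h d as)

¬NW-Sol : ∀ {M} (f g : Fin M → Fin M) (finv : Fin M → Maybe (Fin M)) {v} →
          f (f (g v)) ≡ f v → f (g v) ≢ v → (∀ {w} → finv v ≡ just w → f w ≡ v) →
          (finv v ≡ nothing → f (f v) ≡ f v) → ¬ NW-Sol f g finv v
¬NW-Sol f g finv grand _    _   _   (inj₁ ne)                         = ne grand
¬NW-Sol f g finv _     nfix _   _   (inj₂ (inj₁ eq))                  = nfix eq
¬NW-Sol f g finv _     _    inv _   (inj₂ (inj₂ (inj₁ (_ , eq , ne)))) = ne (inv eq)
¬NW-Sol f g finv _     _    _   bot (inj₂ (inj₂ (inj₂ (eq , ne))))    = ne (bot eq)

module Reduction (n : ℕ) where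

  V : Set
  V = Fin (suc n)

  HasTwoChildren : V → V → V → Set
  HasTwoChildren p lp rp = lp ≢ p × rp ≢ p

  hasTwoChildren? : ∀ p lp rp → Dec (HasTwoChildren p lp rp)
  hasTwoChildren? p lp rp = ¬? (lp ≟ p) ×-dec ¬? (rp ≟ p)

  ProperChild : V → V → V → V → Set
  ProperChild u p lp rp = u ≢ zero × p ≢ u × (lp ≡ u ⊎ rp ≡ u) × HasTwoChildren p lp rp

  properChild? : ∀ u p lp rp → Dec (ProperChild u p lp rp)
  properChild? u p lp rp =
    ¬? (u ≟ zero) ×-dec ¬? (p ≟ u) ×-dec (lp ≟ u ⊎-dec rp ≟ u)
      ×-dec hasTwoChildren? p lp rp

  parentRule : V → V → V → V → V
  parentRule u p lp rp = if does (properChild? u p lp rp) then p else zero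

  siblingRule : V → V → V → V
  siblingRule u lp rp = if does (lp ≟ u) then rp else lp

  nephewRule : V → V → V → V → V → V → V
  nephewRule u p lp rp nephew fallback =
    if does (properChild? u p lp rp) then nephew else fallback

  inverseRule : V → V → V → Maybe V
  inverseRule v lv rv = if does (hasTwoChildren? v lv rv) then just lv else nothing

  RootView : Set
  RootView = V × V × V

  View : Set
  View = V × V × V × V

  LocalSol : RootView → V → View → Set
  LocalSol (l₀ , r₀ , f₀) u (lu , ru , flu , fru) =
    ((flu ≢ u) ⊎ (fru ≢ u) ⊎ (lu ≡ ru × ru ≢ u))
    ⊎ (u ≡ zero × ((l₀ ≡ zero) ⊎ (r₀ ≡ zero) ⊎ (f₀ ≢ zero)))

  LocalSol? : ∀ root u view → Dec (LocalSol root u view)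
  LocalSol? (l₀ , r₀ , f₀) u (lu , ru , flu , fru) =
    (¬? (flu ≟ u) ⊎-dec ¬? (fru ≟ u) ⊎-dec (lu ≟ ru ×-dec ¬? (ru ≟ u)))
    ⊎-dec (u ≟ zero ×-dec (l₀ ≟ zero ⊎-dec r₀ ≟ zero ⊎-dec ¬? (f₀ ≟ zero)))

  module Trees where
    open BoundedDT {ECQuery (suc n)} {λ _ → V}

    parentTree : V → DT≤ V 3
    parentTree u = do
      p  ← ask (qF u)
      lp ← ask (qL p)
      rp ← ask (qR p)
      return (parentRule u p lp rp)

    nephewTree : V → DT≤ V 6
    nephewTree u = do
      p      ← ask (qF u)
      lp     ← ask (qL p)
      rp     ← ask (qR p)
      nephew ← ask (qL (siblingRule u lp rp))
      a      ← ask (qL zero)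
      la     ← ask (qL a)
      return (nephewRule u p lp rp nephew la)

    inverseTree : V → DT≤ (Maybe V) 2
    inverseTree v = do
      lv ← ask (qL v)
      rv ← ask (qR v)
      return (inverseRule v lv rv)

    instanceTree : (q : NWQuery (suc n)) → DT≤ (NWAnswer (suc n) q) 6
    instanceTree (qf u)    = weaken (m≤m+n 3 3) (parentTree u)
    instanceTree (qg u)    = nephewTree u
    instanceTree (qfinv v) = weaken (m≤m+n 2 4) (inverseTree v)

    viewTree : V → DT≤ View 4
    viewTree u = do
      lu  ← ask (qL u)
      ru  ← ask (qR u)
      flu ← ask (qF lu)
      fru ← ask (qF ru)
      return (lu , ru , flu , fru)

    viewsTree : (ws : List V) → DT≤ (List (V × View)) (length ws * 4)
    viewsTree []       = return []
    viewsTree (w ∷ ws) = viewTree w >>= λ view → ((w , view) ∷_) <$> viewsTree ws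

    outputTree : V → DT≤ V 30
    outputTree v = do
      l₀    ← ask (qL zero)
      r₀    ← ask (qR zero)
      f₀    ← ask (qF zero)
      p     ← ask (qF v)
      lp    ← ask (qL p)
      rp    ← ask (qR p)
      views ← viewsTree (zero ∷ l₀ ∷ v ∷ p ∷ lp ∷ rp ∷ [])
      return (firstWitness (LocalSol? (l₀ , r₀ , f₀)) v views)

  module Semantics (F L R : V → V) where

    f : V → V
    f u = parentRule u (F u) (L (F u)) (R (F u))

    g : V → V
    g u = nephewRule u (F u) (L (F u)) (R (F u))
            (L (siblingRule u (L (F u)) (R (F u)))) (L (L zero))

    finv : V → Maybe V
    finv v = inverseRule v (L v) (R v)

    rootView : RootView
    rootView = L zero , R zero , F zero

    view : V → View
    view u = L u , R u , F (L u) , F (R u)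

    EC-Sol : V → Set
    EC-Sol u = LocalSol rootView u (view u)

    record Consistent (w : V) : Set where
      field
        parent-left  : F (L w) ≡ w
        parent-right : F (R w) ≡ w
        equal-children-empty : L w ≡ R w → R w ≡ w

    open Consistent

    consistent : ∀ {w} → ¬ EC-Sol w → Consistent w
    consistent ¬sol = record
      { parent-left  = decidable-stable (_ ≟ _) λ ne → ¬sol (inj₁ (inj₁ ne))
      ; parent-right = decidable-stable (_ ≟ _) λ ne → ¬sol (inj₁ (inj₂ (inj₁ ne)))
      ; equal-children-empty = λ eq →
          decidable-stable (_ ≟ _) λ ne → ¬sol (inj₁ (inj₂ (inj₂ (eq , ne))))
      }

    hasTwoChildren : ∀ {w} → Consistent w → F w ≢ w → HasTwoChildren w (L w) (R w)
    hasTwoChildren Cw Fw≢w =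
      (λ Lw≡w → Fw≢w (trans (cong F (sym Lw≡w)) (parent-left Cw))) ,
      (λ Rw≡w → Fw≢w (trans (cong F (sym Rw≡w)) (parent-right Cw)))

    child-elim : ∀ (P : V → Set) {p s} → P (L p) → P (R p) → L p ≡ s ⊎ R p ≡ s → P s
    child-elim P PL PR (inj₁ refl) = PL
    child-elim P PL PR (inj₂ refl) = PR

    siblingRule-child : ∀ u lp rp → lp ≡ siblingRule u lp rp ⊎ rp ≡ siblingRule u lp rp
    siblingRule-child u lp rp with lp ≟ u
    ... | yes _ = inj₂ refl
    ... | no  _ = inj₁ refl

    siblingRule-≢ : ∀ {u p} → Consistent p → R p ≢ p → siblingRule u (L p) (R p) ≢ u
    siblingRule-≢ {u} {p} Cp Rp≢p with L p ≟ u
    ... | yes Lp≡u = λ Rp≡u → Rp≢p (equal-children-empty Cp (trans Lp≡u (sym Rp≡u)))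
    ... | no  Lp≢u = Lp≢u

    f-proper : ∀ {u p} → F u ≡ p → ProperChild u p (L p) (R p) → f u ≡ p
    f-proper {u} refl pc rewrite dec-true (properChild? u (F u) (L (F u)) (R (F u))) pc = refl

    f-improper : ∀ {u} → ¬ ProperChild u (F u) (L (F u)) (R (F u)) → f u ≡ zero
    f-improper {u} ¬pc rewrite dec-false (properChild? u (F u) (L (F u)) (R (F u))) ¬pc = refl

    f-orphan : ∀ {u} → F u ≡ zero → f u ≡ zero
    f-orphan {u} Fu≡0 with does (properChild? u (F u) (L (F u)) (R (F u)))
    ... | true  = Fu≡0
    ... | false = refl

    g-proper : ∀ {u} → ProperChild u (F u) (L (F u)) (R (F u)) →
               g u ≡ L (siblingRule u (L (F u)) (R (F u)))
    g-proper {u} pc rewrite dec-true (properChild? u (F u) (L (F u)) (R (F u))) pc = refl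

    g-improper : ∀ {u} → ¬ ProperChild u (F u) (L (F u)) (R (F u)) → g u ≡ L (L zero)
    g-improper {u} ¬pc rewrite dec-false (properChild? u (F u) (L (F u)) (R (F u))) ¬pc = refl

    finv-twoChildren : ∀ {v} → HasTwoChildren v (L v) (R v) → finv v ≡ just (L v)
    finv-twoChildren {v} two rewrite dec-true (hasTwoChildren? v (L v) (R v)) two = refl

    finv-fewerChildren : ∀ {v} → ¬ HasTwoChildren v (L v) (R v) → finv v ≡ nothing
    finv-fewerChildren {v} ¬two rewrite dec-false (hasTwoChildren? v (L v) (R v)) ¬two = refl

    module Rooted (¬sol-root : ¬ EC-Sol zero) where
      open ≡-Reasoning

      Croot : Consistent zero
      Croot = consistent ¬sol-root

      F-root : F zero ≡ zero
      F-root = decidable-stable (_ ≟ _) λ ne → ¬sol-root (inj₂ (refl , inj₂ (inj₂ ne)))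

      L-root≢root : L zero ≢ zero
      L-root≢root eq = ¬sol-root (inj₂ (refl , inj₁ eq))

      R-root≢root : R zero ≢ zero
      R-root≢root eq = ¬sol-root (inj₂ (refl , inj₂ (inj₁ eq)))

      ≢root : ∀ {w} → F w ≢ w → w ≢ zero
      ≢root Fw≢w refl = Fw≢w F-root

      f-left : ∀ {w} → Consistent w → HasTwoChildren w (L w) (R w) → f (L w) ≡ w
      f-left Cw two@(Lw≢w , _) =
        f-proper (parent-left Cw) (≢root FLw≢Lw , (λ eq → Lw≢w (sym eq)) , inj₁ refl , two)
        where
        FLw≢Lw : F (L _) ≢ L _
        FLw≢Lw eq = Lw≢w (trans (sym eq) (parent-left Cw))

      finv-sound : ∀ {v w} → Consistent v → finv v ≡ just w → f w ≡ v
      finv-sound {v} Cv eq with hasTwoChildren? v (L v) (R v)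
      ... | yes two with refl ← trans (sym (finv-twoChildren two)) eq = f-left Cv two
      ... | no ¬two with () ← trans (sym (finv-fewerChildren ¬two)) eq

      nephew-free-proper : ∀ {v} → ProperChild v (F v) (L (F v)) (R (F v)) →
                           Consistent v → Consistent (F v) →
                           ¬ EC-Sol (L (F v)) → ¬ EC-Sol (R (F v)) → ¬ NW-Sol f g finv v
      nephew-free-proper {v} pc@(_ , p≢v , _ , two-p) Cv Cp ¬sol-lp ¬sol-rp =
        ¬NW-Sol f g finv grand (λ eq → s≢v (trans (sym fgv≡s) eq)) (finv-sound Cv) bot
        where
        p s : V
        p = F v
        s = siblingRule v (L p) (R p)
        s-child : L p ≡ s ⊎ R p ≡ s
        s-child = siblingRule-child v (L p) (R p)
        s≢v : s ≢ v
        s≢v = siblingRule-≢ Cp (proj₂ two-p)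
        Fs≡p : F s ≡ p
        Fs≡p = child-elim (λ c → F c ≡ p) (parent-left Cp) (parent-right Cp) s-child
        s≢p : s ≢ p
        s≢p = child-elim (λ c → c ≢ p) (proj₁ two-p) (proj₂ two-p) s-child
        Fs≢s : F s ≢ s
        Fs≢s eq = s≢p (trans (sym eq) Fs≡p)
        Cs : Consistent s
        Cs = child-elim Consistent (consistent ¬sol-lp) (consistent ¬sol-rp) s-child
        s-proper : ProperChild s p (L p) (R p)
        s-proper = ≢root Fs≢s , (λ eq → s≢p (sym eq)) , s-child , two-p
        fgv≡s : f (g v) ≡ s
        fgv≡s = trans (cong f (g-proper pc)) (f-left Cs (hasTwoChildren Cs Fs≢s))
        grand : f (f (g v)) ≡ f v
        grand = begin
          f (f (g v)) ≡⟨ cong f fgv≡s ⟩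
          f s         ≡⟨ f-proper Fs≡p s-proper ⟩
          p           ≡⟨ sym (f-proper refl pc) ⟩
          f v         ∎
        bot : finv v ≡ nothing → f (f v) ≡ f v
        bot eq with () ← trans (sym (finv-twoChildren (hasTwoChildren Cv p≢v))) eq

      nephew-free-improper : ∀ {v} → ¬ ProperChild v (F v) (L (F v)) (R (F v)) →
                             Consistent v → ¬ EC-Sol (L zero) → ¬ NW-Sol f g finv v
      nephew-free-improper {v} ¬pc Cv ¬sol-a =
        ¬NW-Sol f g finv grand (λ eq → a≢v (trans (sym fgv≡a) eq)) (finv-sound Cv) bot
        where
        a : V
        a = L zero
        Fa≡root : F a ≡ zero
        Fa≡root = parent-left Croot
        Fa≢a : F a ≢ a
        Fa≢a eq = L-root≢root (trans (sym eq) Fa≡root)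
        a-proper : ProperChild a (F a) (L (F a)) (R (F a))
        a-proper rewrite Fa≡root =
          L-root≢root , (λ eq → L-root≢root (sym eq)) , inj₁ refl ,
          L-root≢root , R-root≢root
        a≢v : a ≢ v
        a≢v eq = ¬pc (subst (λ u → ProperChild u (F u) (L (F u)) (R (F u))) eq a-proper)
        Ca : Consistent a
        Ca = consistent ¬sol-a
        fgv≡a : f (g v) ≡ a
        fgv≡a = trans (cong f (g-improper ¬pc)) (f-left Ca (hasTwoChildren Ca Fa≢a))
        grand : f (f (g v)) ≡ f v
        grand = begin
          f (f (g v)) ≡⟨ cong f fgv≡a ⟩
          f a         ≡⟨ f-orphan Fa≡root ⟩
          zero        ≡⟨ sym (f-improper ¬pc) ⟩
          f v         ∎
        bot : finv v ≡ nothing → f (f v) ≡ f v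
        bot _ = begin
          f (f v) ≡⟨ cong f (f-improper ¬pc) ⟩
          f zero  ≡⟨ f-orphan F-root ⟩
          zero    ≡⟨ sym (f-improper ¬pc) ⟩
          f v     ∎

    candidates : V → List V
    candidates v = zero ∷ L zero ∷ v ∷ F v ∷ L (F v) ∷ R (F v) ∷ []

    nephew-free : ∀ {v} → All (λ w → ¬ EC-Sol w) (candidates v) → ¬ NW-Sol f g finv v
    nephew-free {v} (¬sol-root ∷ ¬sol-a ∷ ¬sol-v ∷ ¬sol-p ∷ ¬sol-lp ∷ ¬sol-rp ∷ [])
      with properChild? v (F v) (L (F v)) (R (F v))
    ... | yes pc  =
      nephew-free-proper pc (consistent ¬sol-v) (consistent ¬sol-p) ¬sol-lp ¬sol-rp
      where open Rooted ¬sol-root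
    ... | no  ¬pc = nephew-free-improper ¬pc (consistent ¬sol-v) ¬sol-a
      where open Rooted ¬sol-root

  -- The trees are built from concrete queries, so `eval` of each of them
  -- reduces definitionally to the corresponding function of F, L and R.
  module _ (x : ECQuery (suc n) → V) where
    open Trees
    open Semantics (λ i → x (qF i)) (λ i → x (qL i)) (λ i → x (qR i))

    output-sound : ∀ v → NW-Sol f g finv v → EC-Sol (eval (proj₁ (outputTree v)) x)
    output-sound v sol
      with firstWitness-sound (LocalSol? rootView) view v (candidates v)
    ... | inj₁ found     = found
    ... | inj₂ none-sol  = contradiction sol (nephew-free none-sol)

theorem5p12 : EmptyChild ≤dt NephewWInverse
theorem5p12 = 5 , reduction
  where
  reduction : (n : ℕ) → DtRedAt EmptyChild NephewWInverse 5 n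
  reduction n = record
    { m         = n
    ; instT     = λ q → proj₁ (instanceTree q)
    ; outT      = λ v → proj₁ (outputTree v)
    ; correct   = output-sound
    ; logSize   = log₂≤polylog 4 (suc n)
    ; instDepth = λ q → depth≤polylog (proj₂ (instanceTree q)) (m≤m+n 6 26)
    ; outDepth  = λ v → depth≤polylog (proj₂ (outputTree v)) (m≤m+n 30 2)
    }
    where
    open Reduction n
    open Trees
    depth≤polylog : ∀ {R} {t : DT (ECQuery (suc n)) (λ _ → V) R} {d} →
                    DepthLe t d → d ≤ 2 ^ 5 → DepthLe t (polylog 5 (suc n))
    depth≤polylog t≤d d≤32 =
      BoundedDT.DepthLe-mono t≤d (≤-trans d≤32 (2^c≤polylog 5 (suc n)))
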